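{- Let $\mathcal{V}$ be an $\alpha$-valuation of the complete bipartite graph $K_{a,b}$ with $ab>1$. Then there exists an integer $\ell>1$ such that $\mathcal{V}$ is equivalent to an $\alpha$-valuation $(V^{\sf small},V^{\sf large})$ with the following properties: (1) every element of $V^{\sf small}$ is a multiple of $\ell$; (2) the set $V^{\sf large}$ is a union of runs of $\ell$ consecutive integers each of which ends with a multiple of $\ell$ (i.e., of sets $\{i\ell-\ell+1,\dots,i\ell-1,i\ell\}$).
   Context: For a graph $G$ with $n$ edges, an $\alpha$-valuation is a one-to-one map from the vertices into $\{0,1,\dots,n\}$ such that the absolute differences of the labels of the endpoints of the edges are exactly $\{1,\dots,n\}$, and there is a value $x$ with $0\le x\le n$ such that every edge joins a vertex with label $\le x$ to one with label $>x$. Vertices are identified with labels; $V^{\sf small}$ is the set of labels $\le x$ and $V^{\sf large}$ the set of labels $>x$. For $K_{a,b}$ the labels lie in $\{0,\dots,ab\}$. Define $\Phi_{ab}(z)=ab-z$ on $\{0,\dots,ab\}$. Two $\alpha$-valuations $\mathcal{V}_1,\mathcal{V}_2$ of $K_{a,b}$ are equivalent if $\mathcal{V}_1=\mathcal{V}_2$, or if for every vertex its label in $\mathcal{V}_2$ is obtained by applying $\Phi_{ab}$ to its label in $\mathcal{V}_1$. -}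

module Defs where

open import Data.Nat using (ℕ; _+_; _*_; _∸_; _≤_; _<_; ∣_-_∣)
open import Data.Nat.Divisibility using (_∣_)
open import Data.Fin using (Fin)
open import Data.Sum using (_⊎_; inj₁; inj₂)
open import Data.Product using (_×_; Σ; ∃; ∃-syntax; _,_)
open import Data.List using (List)
open import Data.List.Membership.Propositional using (_∈_)
open import Relation.Binary.PropositionalEquality using (_≡_)
open import Function.Definitions using (Injective)

-- Vertices of K_{a,b}: the two parts Fin a and Fin b; edges = all pairs (inj₁ i , inj₂ j).
Vertex : ℕ → ℕ → Set
Vertex a b = Fin a ⊎ Fin b

Labelling : ℕ → ℕ → Set
Labelling a b = Vertex a b → ℕ

record IsAlphaValuationWith (a b : ℕ) (f : Labelling a b) (x : ℕ) : Set where
  field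
    injective   : Injective _≡_ _≡_ f
    bounded     : ∀ v → f v ≤ a * b
    diff-range  : ∀ i j → 1 ≤ ∣ f (inj₁ i) - f (inj₂ j) ∣ × ∣ f (inj₁ i) - f (inj₂ j) ∣ ≤ a * b
    diff-onto   : ∀ d → 1 ≤ d → d ≤ a * b →
                  ∃[ i ] ∃[ j ] ∣ f (inj₁ i) - f (inj₂ j) ∣ ≡ d
    x-bound     : x ≤ a * b
    threshold   : ∀ i j → (f (inj₁ i) ≤ x × x < f (inj₂ j)) ⊎ (f (inj₂ j) ≤ x × x < f (inj₁ i))

IsAlphaValuation : (a b : ℕ) → Labelling a b → Set
IsAlphaValuation a b f = ∃[ x ] IsAlphaValuationWith a b f x

Φ : ℕ → ℕ → ℕ → ℕ
Φ a b z = a * b ∸ z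

Equivalent : (a b : ℕ) → Labelling a b → Labelling a b → Set
Equivalent a b f g = (∀ v → g v ≡ f v) ⊎ (∀ v → g v ≡ Φ a b (f v))

InSmall : ∀ {a b} → Labelling a b → ℕ → ℕ → Set
InSmall f x z = ∃[ v ] (f v ≡ z × z ≤ x)

InLarge : ∀ {a b} → Labelling a b → ℕ → ℕ → Set
InLarge f x z = ∃[ v ] (f v ≡ z × x < z)

InRun : ℕ → ℕ → ℕ → Set
InRun ℓ i z = (i * ℓ ∸ ℓ + 1 ≤ z) × (z ≤ i * ℓ)

-- Let S be the set of small labels and T = Φ(V^large) = {ab − l ∣ l large}.  The ab
-- edge differences l − s are exactly 1, …, ab, so every k < ab is uniquely s + t with
-- s ∈ S and t ∈ T: the pair (T, S) tiles {0, …, ab − 1}.  Such tilings are rigid: if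
-- 1 ∈ T and m is the least natural number outside T, then m ∣ ab, every element of S
-- is a multiple of m, and T is a union of blocks {qm, …, qm + m − 1}; this follows by
-- strong induction on k < ab, comparing the splittings of k and of qm.  Reflecting
-- through Φ turns the blocks of T into the runs {im − m + 1, …, im} of V^large.
-- Finally, splitting 1 = s + t puts 1 in T or in S; in the second case the argument
-- applies to the equivalent valuation Φ ∘ f, whose T is the old S.

module Submission where

open import Defs
open import Data.Nat
  using (ℕ; zero; suc; pred; _+_; _*_; _∸_; _≤_; _<_; _≟_; _<?_; ∣_-_∣; z≤n; s≤s; z<s;
         NonZero; >-nonZero; >-nonZero⁻¹)
open import Data.Nat.Properties
open import Data.Nat.DivMod
open import Data.Nat.Divisibility using (_∣_; n∣m*n; ∣m∣n⇒∣m+n; ∣-refl; m%n≡0⇒n∣m)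
open import Data.Nat.Induction using (<-rec)
open import Data.Fin using (Fin; toℕ; fromℕ; fromℕ<; punchOut; combine; remQuot)
open import Data.Fin.Properties
  using (¬∀⟶∃¬-smallest; toℕ-fromℕ; toℕ-fromℕ<; toℕ-inject; toℕ-injective; toℕ<n;
         punchOut-injective; injective⇒≤; remQuot-combine; combine-injective; any?)
import Data.Fin.Properties as Fin
open import Data.Product using (∃; ∃₂; ∃-syntax; _×_; _,_; proj₁; proj₂)
import Data.Sum as Sum
open import Data.Sum using (_⊎_; inj₁; inj₂; [_,_]′)
open import Data.List using (List; map; filter; _++_; allFin)
open import Data.List.Membership.Propositional using (_∈_)
open import Data.List.Membership.Propositional.Properties
  using (∈-map⁺; ∈-++⁺ˡ; ∈-++⁺ʳ; ∈-allFin; ∈-map∘filter⁺; ∈-map∘filter⁻)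
open import Function.Base using (_∘_; const)
open import Function.Bundles using (_⇔_; mk⇔; Equivalence)
open import Function.Definitions using (Injective)
open import Relation.Nullary using (¬_; Dec; yes; no; contradiction)
open import Relation.Nullary.Decidable using (map′; _⊎-dec_; _×-dec_)
open import Relation.Binary.PropositionalEquality

least-counterexample : ∀ {P : ℕ → Set} → (∀ k → Dec (P k)) → ∀ n → ¬ P n →
                       ∃[ m ] (¬ P m × (∀ {k} → k < m → P k))
least-counterexample {P} P? n ¬Pn
  with ¬∀⟶∃¬-smallest (suc n) (P ∘ toℕ) (P? ∘ toℕ) (¬Pn ∘ at-n)
  where
  at-n : (∀ i → P (toℕ i)) → P n
  at-n all = subst P (toℕ-fromℕ n) (all (fromℕ n))
... | i , ¬Pi , below =
  toℕ i , ¬Pi , λ k<i → subst P (trans (toℕ-inject _) (toℕ-fromℕ< k<i)) (below (fromℕ< k<i))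

surjective⇒injective : ∀ {n} (g : Fin n → Fin n) → (∀ y → ∃[ x ] g x ≡ y) → Injective _≡_ _≡_ g
surjective⇒injective {suc n} g surj {x} {y} gx≡gy with x Fin.≟ y
... | yes x≡y = x≡y
... | no x≢y = contradiction (injective⇒≤ punched-injective) 1+n≰n
  where
  open ≡-Reasoning
  h : Fin (suc n) → Fin (suc n)
  h t = proj₁ (surj t)
  g∘h : ∀ t → g (h t) ≡ t
  g∘h t = proj₂ (surj t)
  -- One of x, y is a preimage of g x other than h (g x), so the section h misses it.
  other : ∃[ w ] (g w ≡ g x × h (g x) ≢ w)
  other with h (g x) Fin.≟ x
  ... | yes hgx≡x = y , sym gx≡gy , λ hgx≡y → x≢y (trans (sym hgx≡x) hgx≡y)
  ... | no hgx≢x = x , refl , hgx≢x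
  w : Fin (suc n)
  w = proj₁ other
  w∉image : ∀ t → w ≢ h t
  w∉image t w≡ht = proj₂ (proj₂ other) (begin
    h (g x)      ≡⟨ cong h (proj₁ (proj₂ other)) ⟨
    h (g w)      ≡⟨ cong (h ∘ g) w≡ht ⟩
    h (g (h t))  ≡⟨ cong h (g∘h t) ⟩
    h t          ≡⟨ w≡ht ⟨
    w            ∎)
  punched-injective : Injective _≡_ _≡_ (λ t → punchOut (w∉image t))
  punched-injective {s} {t} e = begin
    s           ≡⟨ g∘h s ⟨
    g (h s)     ≡⟨ cong g (punchOut-injective (w∉image s) (w∉image t) e) ⟩
    g (h t)     ≡⟨ g∘h t ⟩
    t           ∎

[m+kn]/n≡k : ∀ {m} k n .{{_ : NonZero n}} → m < n → (m + k * n) / n ≡ k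
[m+kn]/n≡k {m} k n m<n = trans (+-distrib-/-∣ʳ m (n∣m*n k)) (cong₂ _+_ (m<n⇒m/n≡0 m<n) (m*n/n≡m k n))

divMod-unique : ∀ {m r r' q q'} .{{_ : NonZero m}} → r < m → r' < m →
                r + q * m ≡ r' + q' * m → r ≡ r' × q ≡ q'
divMod-unique {m} {r} {r'} {q} {q'} r<m r'<m eq = +-cancelʳ-≡ (q * m) r r' eq′ , q≡q'
  where
  open ≡-Reasoning
  q≡q' : q ≡ q'
  q≡q' = begin
    q                    ≡⟨ [m+kn]/n≡k q m r<m ⟨
    (r + q * m) / m      ≡⟨ /-congˡ eq ⟩
    (r' + q' * m) / m    ≡⟨ [m+kn]/n≡k q' m r'<m ⟩
    q'                   ∎
  eq′ : r + q * m ≡ r' + q * m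
  eq′ = trans eq (cong (λ t → r' + t * m) (sym q≡q'))

-- Tilings of {0, …, n − 1}

record IsTiling (A B : ℕ → Set) (n : ℕ) : Set where
  field
    cover  : ∀ {k} → k < n → ∃₂ λ a b → A a × B b × a + b ≡ k
    bound  : ∀ {a b} → A a → B b → a + b < n
    unique : ∀ {a b a' b'} → A a → B b → A a' → B b' → a + b ≡ a' + b' → a ≡ a'

  uniqueʳ : ∀ {a b a' b'} → A a → B b → A a' → B b' → a + b ≡ a' + b' → b ≡ b'
  uniqueʳ {a} {b} {a'} {b'} Aa Bb Aa' Bb' eq =
    +-cancelˡ-≡ a' b b' (trans (cong (_+ b) (sym (unique Aa Bb Aa' Bb' eq))) eq)

tiling-swap : ∀ {A B n} → IsTiling A B n → IsTiling B A n
tiling-swap {A} {B} {n} tiling = record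
  { cover  = λ k<n → let a , b , Aa , Bb , a+b≡k = cover k<n in b , a , Bb , Aa , trans (+-comm b a) a+b≡k
  ; bound  = λ {b} {a} Bb Aa → subst (_< n) (+-comm a b) (bound Aa Bb)
  ; unique = λ {b} {a} {b'} {a'} Bb Aa Bb' Aa' eq →
      uniqueʳ Aa Bb Aa' Bb' (trans (+-comm a b) (trans eq (+-comm b' a')))
  }
  where open IsTiling tiling

module NonEmptyTiling {A B : ℕ → Set} {n} (tiling : IsTiling A B n) (0<n : 0 < n) where
  open IsTiling tiling

  0∈A : A 0
  0∈A = let a , _ , Aa , _ , a+b≡0 = cover 0<n in subst A (m+n≡0⇒m≡0 a a+b≡0) Aa

  0∈B : B 0
  0∈B = let a , _ , _ , Bb , a+b≡0 = cover 0<n in subst B (m+n≡0⇒n≡0 a a+b≡0) Bb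

  A<n : ∀ {a} → A a → a < n
  A<n {a} Aa = subst (_< n) (+-identityʳ a) (bound Aa 0∈B)

  B<n : ∀ {b} → B b → b < n
  B<n = bound 0∈A

  A∩B≡0 : ∀ {k} → A k → B k → k ≡ 0
  A∩B≡0 {k} Ak Bk = unique Ak 0∈B 0∈A Bk (+-identityʳ k)

  1∈A⊎1∈B : 1 < n → A 1 ⊎ B 1
  1∈A⊎1∈B 1<n with cover 1<n
  ... | 0 , _ , _ , B1 , refl = inj₂ B1
  ... | 1 , 0 , A1 , _ , _ = inj₁ A1
  ... | 1 , suc _ , _ , _ , ()
  ... | suc (suc _) , _ , _ , _ , ()

module BlockStructure {A B : ℕ → Set} {n} (tiling : IsTiling A B n) (0<n : 0 < n)
  (m : ℕ) .{{_ : NonZero m}} (A-below-m : ∀ {k} → k < m → A k) (m∉A : ¬ A m) where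
  open IsTiling tiling
  open NonEmptyTiling tiling 0<n
  open ≡-Reasoning

  private
    instance
      n-nonZero : NonZero n
      n-nonZero = >-nonZero 0<n

    pred[n]<n : pred n < n
    pred[n]<n = subst (pred n <_) (suc-pred n) ≤-refl

  m≤n : m ≤ n
  m≤n = ≮⇒≥ (λ n<m → <-irrefl refl (A<n (A-below-m n<m)))

  m∈B : m < n → B m
  m∈B m<n with cover m<n
  ... | c , d , Ac , Bd , c+d≡m with m≤n⇒m<n∨m≡n (subst (d ≤_) c+d≡m (m≤n+m d c))
  ...   | inj₂ d≡m = subst B d≡m Bd
  ...   | inj₁ d<m = contradiction (subst A c≡m Ac) m∉A
    where
    c≡m : c ≡ m
    c≡m = trans (sym (+-identityʳ c)) (subst (λ t → c + t ≡ m) (A∩B≡0 (A-below-m d<m) Bd) c+d≡m)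

  -- s = m ∸ r ∈ A and m ∈ B, so r + c ∈ B would give the second splitting s + (r + c) = c + m.
  ∉B-shortly-after : ∀ {c r} → A c → m ≤ c → 0 < r → r < m → ¬ B (r + c)
  ∉B-shortly-after {c} {r} Ac m≤c 0<r r<m Brc = <-irrefl s≡c (<-≤-trans s<m m≤c)
    where
    s<m : m ∸ r < m
    s<m = ∸-monoʳ-< 0<r (<⇒≤ r<m)
    m<n : m < n
    m<n = ≤-<-trans m≤c (≤-<-trans (m≤n+m c r) (B<n Brc))
    sums : m ∸ r + (r + c) ≡ c + m
    sums = begin
      m ∸ r + (r + c)   ≡⟨ +-assoc (m ∸ r) r c ⟨
      m ∸ r + r + c     ≡⟨ cong (_+ c) (m∸n+n≡m (<⇒≤ r<m)) ⟩
      m + c             ≡⟨ +-comm m c ⟩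
      c + m             ∎
    s≡c : m ∸ r ≡ c
    s≡c = unique (A-below-m s<m) Brc Ac (m∈B m<n) sums

  Blockwise : ℕ → Set
  Blockwise k = k < n → ∀ q {r} → r < m → k ≡ r + q * m → (B k → r ≡ 0) × (A k ⇔ A (q * m))

  private
    Below : ℕ → Set
    Below k = ∀ {k'} → k' < k → Blockwise k'

  aligned-split : ∀ {k c d r} q → Below k → k < n → A c → B d → c < k → d < k → r < m →
                  c + d ≡ r + q * m → ∃[ e ] (A (e * m) × e * m + d ≡ q * m)
  aligned-split {k} {c} {d} {r} q IH k<n Ac Bd c<k d<k r<m c+d≡ = c / m , A[e*m] , em+d≡qm
    where
    IH′ : ∀ {y} → y < k → (B y → y % m ≡ 0) × (A y ⇔ A (y / m * m))
    IH′ {y} y<k = IH y<k (<-trans y<k k<n) (y / m) (m%n<n y m) (m≡m%n+[m/n]*n y m)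
    d≡p*m : d ≡ d / m * m
    d≡p*m = trans (m≡m%n+[m/n]*n d m) (cong (_+ d / m * m) (proj₁ (IH′ d<k) Bd))
    A[e*m] : A (c / m * m)
    A[e*m] = Equivalence.to (proj₂ (IH′ c<k)) Ac
    split : c % m + (c / m + d / m) * m ≡ r + q * m
    split = begin
      c % m + (c / m + d / m) * m         ≡⟨ cong (c % m +_) (*-distribʳ-+ m (c / m) (d / m)) ⟩
      c % m + (c / m * m + d / m * m)     ≡⟨ +-assoc (c % m) _ _ ⟨
      c % m + c / m * m + d / m * m       ≡⟨ cong₂ _+_ (m≡m%n+[m/n]*n c m) d≡p*m ⟨
      c + d                               ≡⟨ c+d≡ ⟩
      r + q * m                           ∎
    e+p≡q : c / m + d / m ≡ q
    e+p≡q = proj₂ (divMod-unique {q = c / m + d / m} {q} (m%n<n c m) r<m split)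
    em+d≡qm : c / m * m + d ≡ q * m
    em+d≡qm = begin
      c / m * m + d            ≡⟨ cong (c / m * m +_) d≡p*m ⟩
      c / m * m + d / m * m    ≡⟨ *-distribʳ-+ m (c / m) (d / m) ⟨
      (c / m + d / m) * m      ≡⟨ cong (_* m) e+p≡q ⟩
      q * m                    ∎

  A-block-interior : ∀ q {r} → Below (r + q * m) → r + q * m < n → 0 < r → r < m →
                     m ≤ q * m → A (q * m) → ¬ B (r + q * m) × A (r + q * m)
  A-block-interior q {r} IH k<n 0<r r<m m≤qm AQ = ¬Bk , Ak
    where
    ¬Bk : ¬ B (r + q * m)
    ¬Bk = ∉B-shortly-after AQ m≤qm 0<r r<m
    -- A splitting c + d of k with d ≠ 0 would realign to a second splitting e * m + d of q * m + 0.
    Ak : A (r + q * m)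
    Ak with cover k<n
    ... | c , zero , Ac , _ , c+0≡k = subst A (trans (sym (+-identityʳ c)) c+0≡k) Ac
    ... | c , suc d , Ac , Bd , c+d≡k with m≤n⇒m<n∨m≡n (subst (suc d ≤_) c+d≡k (m≤n+m (suc d) c))
    ...   | inj₂ d≡k = contradiction (subst B d≡k Bd) ¬Bk
    ...   | inj₁ d<k with aligned-split q IH k<n Ac Bd c<k d<k r<m c+d≡k
      where
      c<k : c < r + q * m
      c<k = subst (c <_) c+d≡k (m<m+n c z<s)
    ...     | e , Aem , em+d≡qm =
      contradiction (uniqueʳ Aem Bd AQ 0∈B (trans em+d≡qm (sym (+-identityʳ (q * m))))) λ ()

  non-A-block-interior : ∀ q {r c d} → Below (suc r + q * m) → suc r + q * m < n → suc r < m →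
                         A c → B (suc d) → c + suc d ≡ q * m →
                         ¬ B (suc r + q * m) × ¬ A (suc r + q * m) × ¬ A (q * m)
  non-A-block-interior q {r} {c} {d} IH k<n r<m Ac Bd c+d≡qm
    with aligned-split q IH k<n Ac Bd c<k d<k (>-nonZero⁻¹ m) c+d≡qm
    where
    qm<k : q * m < suc r + q * m
    qm<k = m<n+m (q * m) z<s
    c<k : c < suc r + q * m
    c<k = <-trans (subst (c <_) c+d≡qm (m<m+n c z<s)) qm<k
    d<k : suc d < suc r + q * m
    d<k = ≤-<-trans (subst (suc d ≤_) c+d≡qm (m≤n+m (suc d) c)) qm<k
  ... | e , Aem , em+d≡qm = ¬Bk , ¬Ak , ¬AQ
    where
    -- v lies in the block of e * m ∈ A, and v + d = k is a second splitting of k.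
    v : ℕ
    v = suc r + e * m
    v+d≡k : v + suc d ≡ suc r + q * m
    v+d≡k = trans (+-assoc (suc r) (e * m) (suc d)) (cong (suc r +_) em+d≡qm)
    v<k : v < suc r + q * m
    v<k = subst (v <_) v+d≡k (m<m+n v z<s)
    Av : A v
    Av = Equivalence.from (proj₂ (IH v<k (<-trans v<k k<n) e r<m refl)) Aem
    ¬Bk : ¬ B (suc r + q * m)
    ¬Bk Bk = contradiction (unique Av Bd 0∈A Bk v+d≡k) λ ()
    ¬Ak : ¬ A (suc r + q * m)
    ¬Ak Ak = contradiction (uniqueʳ Ak 0∈B Av Bd (trans (+-identityʳ _) (sym v+d≡k))) λ ()
    ¬AQ : ¬ A (q * m)
    ¬AQ AQ = contradiction (uniqueʳ AQ 0∈B Ac Bd (trans (+-identityʳ _) (sym c+d≡qm))) λ ()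

  blockwise : ∀ k → Blockwise k
  blockwise = <-rec Blockwise step
    where
    step : ∀ k → Below k → Blockwise k
    step _ IH k<n q {zero} r<m refl = (λ _ → refl) , mk⇔ (λ Ak → Ak) (λ AQ → AQ)
    step _ IH k<n zero {suc r} r<m refl =
        (λ Bk → contradiction (A∩B≡0 Ak Bk) λ ()) , mk⇔ (const 0∈A) (const Ak)
      where
      Ak : A (suc r + 0)
      Ak = A-below-m (subst (_< m) (sym (+-identityʳ (suc r))) r<m)
    step _ IH k<n (suc q) {suc r} r<m refl with cover (≤-<-trans (m≤n+m (suc q * m) (suc r)) k<n)
    ... | c , zero , Ac , _ , c+0≡qm =
      let AQ = subst A (trans (sym (+-identityʳ c)) c+0≡qm) Ac
          ¬Bk , Ak = A-block-interior (suc q) IH k<n z<s r<m (m≤m+n m (q * m)) AQ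
      in (λ Bk → contradiction Bk ¬Bk) , mk⇔ (const AQ) (const Ak)
    ... | c , suc d , Ac , Bd , c+d≡qm =
      let ¬Bk , ¬Ak , ¬AQ = non-A-block-interior (suc q) IH k<n r<m Ac Bd c+d≡qm
      in (λ Bk → contradiction Bk ¬Bk) , mk⇔ (λ Ak → contradiction Ak ¬Ak) (λ AQ → contradiction AQ ¬AQ)

  B⇒∣ : ∀ {b} → B b → m ∣ b
  B⇒∣ {b} Bb = m%n≡0⇒n∣m b m (proj₁ (blockwise b (B<n Bb) (b / m) (m%n<n b m) (m≡m%n+[m/n]*n b m)) Bb)

  A⇒block-start : ∀ q {r} → r < m → A (r + q * m) → A (q * m)
  A⇒block-start q r<m A[r+qm] = Equivalence.to (proj₂ (blockwise _ (A<n A[r+qm]) q r<m refl)) A[r+qm]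

  block-fits : ∀ q → A (q * m) → q * m + m ≤ n
  block-fits zero    _  = m≤n
  block-fits (suc q) AQ = <⇒≤ (bound AQ (m∈B (≤-<-trans (m≤m+n m (q * m)) (A<n AQ))))

  block⊆A : ∀ q {r} → r < m → A (q * m) → A (r + q * m)
  block⊆A q {r} r<m AQ = Equivalence.from (proj₂ (blockwise _ r+qm<n q r<m refl)) AQ
    where
    r+qm<n : r + q * m < n
    r+qm<n = <-≤-trans (+-monoˡ-< (q * m) r<m) (subst (_≤ n) (+-comm (q * m) m) (block-fits q AQ))

  -- In n − 1 = c + d the summand c ∈ A ends its block: otherwise c + 1 ∈ A and (c + 1) + d = n.
  m∣n : m ∣ n
  m∣n with cover pred[n]<n
  ... | c , d , Ac , Bd , c+d≡n-1 = subst (m ∣_) 1+c+d≡n (∣m∣n⇒∣m+n m∣1+c (B⇒∣ Bd))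
    where
    r q : ℕ
    r = c % m
    q = c / m
    c≡ : c ≡ r + q * m
    c≡ = m≡m%n+[m/n]*n c m
    1+c+d≡n : suc c + d ≡ n
    1+c+d≡n = trans (cong suc c+d≡n-1) (suc-pred n)
    AQ : A (q * m)
    AQ = A⇒block-start q (m%n<n c m) (subst A c≡ Ac)
    1+r≡m : suc r ≡ m
    1+r≡m with m≤n⇒m<n∨m≡n (m%n<n c m)
    ... | inj₂ 1+r≡m = 1+r≡m
    ... | inj₁ 1+r<m = contradiction (bound (block⊆A q 1+r<m AQ) Bd)
                                     (<-irrefl (trans (cong (λ t → suc t + d) (sym c≡)) 1+c+d≡n))
    m∣1+c : m ∣ suc c
    m∣1+c = subst (m ∣_) (sym (trans (cong suc c≡) (cong (_+ q * m) 1+r≡m)))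
                  (∣m∣n⇒∣m+n ∣-refl (n∣m*n q))

-- α-valuations of K_{a,b} as tilings

InΦLarge : ∀ {a b} → Labelling a b → ℕ → ℕ → Set
InΦLarge {a} {b} f x z = InLarge f x (Φ a b z)

vertices : ∀ a b → List (Vertex a b)
vertices a b = map inj₁ (allFin a) ++ map inj₂ (allFin b)

∈-vertices : ∀ {a b} (v : Vertex a b) → v ∈ vertices a b
∈-vertices (inj₁ i) = ∈-++⁺ˡ (∈-map⁺ inj₁ (∈-allFin i))
∈-vertices {a} (inj₂ j) = ∈-++⁺ʳ (map inj₁ (allFin a)) (∈-map⁺ inj₂ (∈-allFin j))

any-vertex? : ∀ {a b} {P : Vertex a b → Set} → (∀ v → Dec (P v)) → Dec (∃ P)
any-vertex? {P = P} P? = map′ [ (λ (i , p) → inj₁ i , p) , (λ (j , p) → inj₂ j , p) ]′ split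
                      (any? (P? ∘ inj₁) ⊎-dec any? (P? ∘ inj₂))
  where
  split : ∃ P → ∃ (P ∘ inj₁) ⊎ ∃ (P ∘ inj₂)
  split (inj₁ i , p) = inj₁ (i , p)
  split (inj₂ j , p) = inj₂ (j , p)

data Adjacent {a b} : Vertex a b → Vertex a b → Set where
  edge₁₂ : ∀ i j → Adjacent (inj₁ i) (inj₂ j)
  edge₂₁ : ∀ i j → Adjacent (inj₂ j) (inj₁ i)

endpoints : ∀ {a b} {v w : Vertex a b} → Adjacent v w → Fin a × Fin b
endpoints (edge₁₂ i j) = i , j
endpoints (edge₂₁ i j) = i , j

module AlphaValuation {a b} {f : Labelling a b} {x} (α : IsAlphaValuationWith a b f x) where
  open IsAlphaValuationWith α
  open ≡-Reasoning

  gap : Fin a × Fin b → ℕ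
  gap (i , j) = ∣ f (inj₁ i) - f (inj₂ j) ∣

  -- ab edges realise all ab differences, so by counting no difference repeats.
  gap-injective : Injective _≡_ _≡_ gap
  gap-injective {i , j} {i' , j'} eq =
    let i≡i' , j≡j' = combine-injective i j i' j'
          (surjective⇒injective code code-surjective
            (toℕ-injective (trans (toℕ-code i j) (trans (cong pred eq) (sym (toℕ-code i' j'))))))
    in cong₂ _,_ i≡i' j≡j'
    where
    pred-gap<ab : ∀ e → pred (gap e) < a * b
    pred-gap<ab (i , j) = let 1≤gap , gap≤ab = diff-range i j in
      subst (_≤ a * b) (sym (suc-pred (gap (i , j)) {{>-nonZero 1≤gap}})) gap≤ab
    code : Fin (a * b) → Fin (a * b)
    code c = fromℕ< (pred-gap<ab (remQuot b c))
    toℕ-code : ∀ i j → toℕ (code (combine i j)) ≡ pred (gap (i , j))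
    toℕ-code i j = trans (toℕ-fromℕ< _) (cong (pred ∘ gap) (remQuot-combine i j))
    code-surjective : ∀ y → ∃[ c ] code c ≡ y
    code-surjective y with diff-onto (suc (toℕ y)) (s≤s z≤n) (toℕ<n y)
    ... | i , j , gap≡ = combine i j , toℕ-injective (trans (toℕ-code i j) (cong pred gap≡))

  small⇔large : ∀ i j → f (inj₁ i) ≤ x ⇔ x < f (inj₂ j)
  small⇔large i j = mk⇔ to from
    where
    to : f (inj₁ i) ≤ x → x < f (inj₂ j)
    to fi≤x with threshold i j
    ... | inj₁ (_ , x<fj) = x<fj
    ... | inj₂ (_ , x<fi) = contradiction fi≤x (<⇒≱ x<fi)
    from : x < f (inj₂ j) → f (inj₁ i) ≤ x
    from x<fj with threshold i j
    ... | inj₁ (fi≤x , _) = fi≤x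
    ... | inj₂ (fj≤x , _) = contradiction fj≤x (<⇒≱ x<fj)

  some-edge : ∀ {w} → x < f w → Fin a × Fin b
  some-edge {w} x<fw =
    let i , j , _ = diff-onto 1 ≤-refl (≤-trans (≤-trans (s≤s z≤n) x<fw) (bounded w)) in i , j

  small-large-adjacent : ∀ {v w} → f v ≤ x → x < f w → Adjacent v w
  small-large-adjacent {inj₁ i} {inj₂ j} _ _ = edge₁₂ i j
  small-large-adjacent {inj₂ j} {inj₁ i} _ _ = edge₂₁ i j
  small-large-adjacent {inj₁ i} {inj₁ i'} fi≤x x<fi' =
    let j = proj₂ (some-edge x<fi') in
    contradiction (Equivalence.from (small⇔large i' j) (Equivalence.to (small⇔large i j) fi≤x)) (<⇒≱ x<fi')
  small-large-adjacent {inj₂ j} {inj₂ j'} fj≤x x<fj' =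
    let i = proj₁ (some-edge x<fj') in
    contradiction (Equivalence.to (small⇔large i j) (Equivalence.from (small⇔large i j') x<fj')) (≤⇒≯ fj≤x)

  gap-adjacent : ∀ {v w} (e : Adjacent v w) → f v ≤ f w → gap (endpoints e) ≡ f w ∸ f v
  gap-adjacent (edge₁₂ i j) = m≤n⇒∣m-n∣≡n∸m
  gap-adjacent (edge₂₁ i j) = m≤n⇒∣n-m∣≡n∸m

  same-small-end : ∀ {v w v' w'} (e : Adjacent v w) (e' : Adjacent v' w') →
                   endpoints e ≡ endpoints e' → x < f w → f v' ≤ x → v ≡ v'
  same-small-end (edge₁₂ i j) (edge₁₂ i j) refl _ _ = refl
  same-small-end (edge₂₁ i j) (edge₂₁ i j) refl _ _ = refl
  same-small-end (edge₁₂ i j) (edge₂₁ i j) refl x<fw fv'≤x = contradiction fv'≤x (<⇒≱ x<fw)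
  same-small-end (edge₂₁ i j) (edge₁₂ i j) refl x<fw fv'≤x = contradiction fv'≤x (<⇒≱ x<fw)

  small-end-unique : ∀ {v w v' w'} → f v ≤ x → x < f w → f v' ≤ x → x < f w' →
                     f w ∸ f v ≡ f w' ∸ f v' → v ≡ v'
  small-end-unique {v} {w} {v'} {w'} fv≤x x<fw fv'≤x x<fw' eq = same-small-end e e' (gap-injective (begin
      gap (endpoints e)    ≡⟨ gap-adjacent e (≤-trans fv≤x (<⇒≤ x<fw)) ⟩
      _                    ≡⟨ eq ⟩
      _                    ≡⟨ gap-adjacent e' (≤-trans fv'≤x (<⇒≤ x<fw')) ⟨
      gap (endpoints e')   ∎)) x<fw fv'≤x
    where
    e : Adjacent v w
    e = small-large-adjacent fv≤x x<fw
    e' : Adjacent v' w'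
    e' = small-large-adjacent fv'≤x x<fw'

  large-gap : ∀ s {w t} → f w ≡ a * b ∸ t → f w ∸ s ≡ a * b ∸ (s + t)
  large-gap s {w} {t} fw≡ = begin
    f w ∸ s            ≡⟨ cong (_∸ s) fw≡ ⟩
    a * b ∸ t ∸ s      ≡⟨ ∸-+-assoc (a * b) t s ⟩
    a * b ∸ (t + s)    ≡⟨ cong (a * b ∸_) (+-comm t s) ⟩
    a * b ∸ (s + t)    ∎

  split-at-edge : ∀ {v w k} → f v ≤ x → x < f w → f w ∸ f v ≡ a * b ∸ k → k ≤ a * b →
                  ∃₂ λ s t → InSmall f x s × InΦLarge f x t × s + t ≡ k
  split-at-edge {v} {w} {k} fv≤x x<fw gap≡ k≤ab =
    f v , a * b ∸ f w , (v , refl , fv≤x) , (w , fw≡ , subst (x <_) fw≡ x<fw) , sum≡k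
    where
    fw≡ : f w ≡ a * b ∸ (a * b ∸ f w)
    fw≡ = sym (m∸[m∸n]≡n (bounded w))
    sum≤ab : f v + (a * b ∸ f w) ≤ a * b
    sum≤ab = subst (f v + (a * b ∸ f w) ≤_) (m+[n∸m]≡n (bounded w)) (+-monoˡ-≤ _ (≤-trans fv≤x (<⇒≤ x<fw)))
    sum≡k : f v + (a * b ∸ f w) ≡ k
    sum≡k = ∸-cancelˡ-≡ sum≤ab k≤ab (trans (sym (large-gap (f v) fw≡)) gap≡)

  tiling : IsTiling (InSmall f x) (InΦLarge f x) (a * b)
  tiling = record { cover = cover ; bound = bound ; unique = unique }
    where
    cover : ∀ {k} → k < a * b → ∃₂ λ s t → InSmall f x s × InΦLarge f x t × s + t ≡ k
    cover {k} k<ab with diff-onto (a * b ∸ k) (m<n⇒0<n∸m k<ab) (m∸n≤m (a * b) k)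
    ... | i , j , gap≡ with threshold i j
    ...   | inj₁ (fi≤x , x<fj) = split-at-edge fi≤x x<fj
            (trans (sym (gap-adjacent (edge₁₂ i j) (≤-trans fi≤x (<⇒≤ x<fj)))) gap≡) (<⇒≤ k<ab)
    ...   | inj₂ (fj≤x , x<fi) = split-at-edge fj≤x x<fi
            (trans (sym (gap-adjacent (edge₂₁ i j) (≤-trans fj≤x (<⇒≤ x<fi)))) gap≡) (<⇒≤ k<ab)
    bound : ∀ {s t} → InSmall f x s → InΦLarge f x t → s + t < a * b
    bound {s} {t} (_ , _ , s≤x) (_ , _ , x<ab∸t) =
      m≤o∸n⇒m+n≤o (suc s) (<⇒≤ (m∸n≢0⇒n<m (m<n⇒n≢0 x<ab∸t))) (≤-<-trans s≤x x<ab∸t)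
    unique : ∀ {s t s' t'} → InSmall f x s → InΦLarge f x t → InSmall f x s' → InΦLarge f x t' →
             s + t ≡ s' + t' → s ≡ s'
    unique {t = t} {t' = t'} (v , refl , fv≤x) (w , fw≡ , x<) (v' , refl , fv'≤x) (w' , fw'≡ , x<') eq =
      cong f (small-end-unique fv≤x (subst (x <_) (sym fw≡) x<) fv'≤x (subst (x <_) (sym fw'≡) x<') gaps)
      where
      gaps : f w ∸ f v ≡ f w' ∸ f v'
      gaps = begin
        f w ∸ f v                ≡⟨ large-gap (f v) {t = t} fw≡ ⟩
        a * b ∸ (f v + t)        ≡⟨ cong (a * b ∸_) eq ⟩
        a * b ∸ (f v' + t')      ≡⟨ large-gap (f v') {t = t'} fw'≡ ⟨
        f w' ∸ f v'              ∎

  -- 0 ∈ Φ(V^large) says that ab itself is a large label.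
  threshold<ab : 0 < a * b → x < a * b
  threshold<ab 0<ab = proj₂ (proj₂ (NonEmptyTiling.0∈B tiling 0<ab))

∣Φ-Φ∣ : ∀ {n u v} → u ≤ n → v ≤ n → ∣ n ∸ u - n ∸ v ∣ ≡ ∣ u - v ∣
∣Φ-Φ∣ {n} {u} {v} u≤n v≤n = begin
  ∣ n ∸ u - n ∸ v ∣                      ≡⟨ ∣m+n-m+o∣≡∣n-o∣ (u + v) (n ∸ u) (n ∸ v) ⟨
  ∣ u + v + (n ∸ u) - u + v + (n ∸ v) ∣  ≡⟨ cong₂ ∣_-_∣ e₁ e₂ ⟩
  ∣ n + v - n + u ∣                      ≡⟨ ∣m+n-m+o∣≡∣n-o∣ n v u ⟩
  ∣ v - u ∣                              ≡⟨ ∣-∣-comm v u ⟩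
  ∣ u - v ∣                              ∎
  where
  open ≡-Reasoning
  e₁ : u + v + (n ∸ u) ≡ n + v
  e₁ = begin
    u + v + (n ∸ u)    ≡⟨ +-assoc u v (n ∸ u) ⟩
    u + (v + (n ∸ u))  ≡⟨ cong (u +_) (+-comm v (n ∸ u)) ⟩
    u + ((n ∸ u) + v)  ≡⟨ +-assoc u (n ∸ u) v ⟨
    u + (n ∸ u) + v    ≡⟨ cong (_+ v) (m+[n∸m]≡n u≤n) ⟩
    n + v              ∎
  e₂ : u + v + (n ∸ v) ≡ n + u
  e₂ = trans (+-assoc u v (n ∸ v)) (trans (cong (u +_) (m+[n∸m]≡n v≤n)) (+-comm u n))

Φ-valuation : ∀ {a b f x} → IsAlphaValuationWith a b f x → x < a * b →
              IsAlphaValuationWith a b (λ v → Φ a b (f v)) (a * b ∸ suc x)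
Φ-valuation {a} {b} {f} {x} α x<ab = record
  { injective  = λ {u} {v} eq → injective (∸-cancelˡ-≡ (bounded u) (bounded v) eq)
  ; bounded    = λ v → m∸n≤m (a * b) (f v)
  ; diff-range = λ i j → subst (λ d → 1 ≤ d × d ≤ a * b) (sym (Φ-gap i j)) (diff-range i j)
  ; diff-onto  = λ d 1≤d d≤ab → let i , j , gap≡d = diff-onto d 1≤d d≤ab in i , j , trans (Φ-gap i j) gap≡d
  ; x-bound    = m∸n≤m (a * b) (suc x)
  ; threshold  = λ i j → Sum.swap (Sum.map swap-sides swap-sides (threshold i j))
  }
  where
  open IsAlphaValuationWith α
  Φ-gap : ∀ i j → ∣ Φ a b (f (inj₁ i)) - Φ a b (f (inj₂ j)) ∣ ≡ ∣ f (inj₁ i) - f (inj₂ j) ∣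
  Φ-gap i j = ∣Φ-Φ∣ (bounded (inj₁ i)) (bounded (inj₂ j))
  swap-sides : ∀ {u w} → u ≤ x × x < w → a * b ∸ w ≤ a * b ∸ suc x × a * b ∸ suc x < a * b ∸ u
  swap-sides (u≤x , x<w) = ∸-monoʳ-≤ (a * b) x<w , ∸-monoʳ-< (s≤s u≤x) x<ab

small⇒ΦLarge : ∀ {a b} {f : Labelling a b} {x z} → x < a * b → InSmall f x z →
               InΦLarge (λ v → Φ a b (f v)) (a * b ∸ suc x) z
small⇒ΦLarge {a} {b} x<ab (v , fv≡z , z≤x) = v , cong (a * b ∸_) fv≡z , ∸-monoʳ-< (s≤s z≤x) x<ab

ΦΦ-large : ∀ {a b} {g : Labelling a b} {x z} → z ≤ a * b → InΦLarge g x (Φ a b z) ⇔ InLarge g x z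
ΦΦ-large {a} {b} {g} {x} {z} z≤ab = mk⇔ (subst (InLarge g x) Φ∘Φ) (subst (InLarge g x) (sym Φ∘Φ))
  where
  Φ∘Φ : a * b ∸ (a * b ∸ z) ≡ z
  Φ∘Φ = m∸[m∸n]≡n z≤ab

-- Runs

-- ⌈ z / m ⌉ for z > 0
runOf : (m : ℕ) .{{_ : NonZero m}} → ℕ → ℕ
runOf m z = suc (pred z / m)

InRun-runOf : ∀ m .{{_ : NonZero m}} {z} → 0 < z → InRun m (runOf m z) z
InRun-runOf m {suc w} _ = lower , upper
  where
  q : ℕ
  q = w / m
  lower : suc q * m ∸ m + 1 ≤ suc w
  lower = begin
    m + q * m ∸ m + 1   ≡⟨ cong (_+ 1) (m+n∸m≡n m (q * m)) ⟩
    q * m + 1           ≡⟨ +-comm (q * m) 1 ⟩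
    suc (q * m)         ≤⟨ s≤s (m/n*n≤m w m) ⟩
    suc w               ∎
    where open ≤-Reasoning
  upper : w < m + q * m
  upper = begin-strict
    w                   ≡⟨ m≡m%n+[m/n]*n w m ⟩
    w % m + q * m       <⟨ +-monoˡ-< (q * m) (m%n<n w m) ⟩
    m + q * m           ∎
    where open ≤-Reasoning

InRun⇒gap : ∀ m i {z} .{{_ : NonZero m}} → InRun m i z → ∃[ r ] (r < m × z + r ≡ i * m)
InRun⇒gap m i {z} (lower , upper) = i * m ∸ z , m<n+o⇒m∸n<o (i * m) z i*m<z+m , m+[n∸m]≡n upper
  where
  i*m<z+m : i * m < z + m
  i*m<z+m = begin-strict
    i * m              ≤⟨ m≤n+m∸n (i * m) m ⟩
    m + (i * m ∸ m)    <⟨ +-monoʳ-< m (subst (_≤ z) (+-comm (i * m ∸ m) 1) lower) ⟩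
    m + z              ≡⟨ +-comm m z ⟩
    z + m              ∎
    where open ≤-Reasoning

run-index-bound : ∀ m N {i z r} → z + r ≡ i * m → z ≤ N * m → r < m → i ≤ N
run-index-bound m N {i} {z} {r} z+r≡im z≤Nm r<m = m<1+n⇒m≤n (*-cancelʳ-< m i (suc N) (begin-strict
    i * m       ≡⟨ z+r≡im ⟨
    z + r       <⟨ +-mono-≤-< z≤Nm r<m ⟩
    N * m + m   ≡⟨ +-comm (N * m) m ⟩
    suc N * m   ∎))
  where open ≤-Reasoning

reflect-run : ∀ m N {i z r} → z + r ≡ i * m → i ≤ N → N * m ∸ z ≡ r + (N ∸ i) * m
reflect-run m N {i} {z} {r} z+r≡im i≤N = begin
  N * m ∸ z                      ≡⟨ cong (λ t → t * m ∸ z) (m+[n∸m]≡n i≤N) ⟨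
  (i + (N ∸ i)) * m ∸ z          ≡⟨ cong (_∸ z) (*-distribʳ-+ m i (N ∸ i)) ⟩
  i * m + (N ∸ i) * m ∸ z        ≡⟨ cong (λ t → t + (N ∸ i) * m ∸ z) z+r≡im ⟨
  z + r + (N ∸ i) * m ∸ z        ≡⟨ cong (_∸ z) (+-assoc z r ((N ∸ i) * m)) ⟩
  z + (r + (N ∸ i) * m) ∸ z      ≡⟨ m+n∸m≡n z (r + (N ∸ i) * m) ⟩
  r + (N ∸ i) * m                ∎
  where open ≡-Reasoning

RunStructured : ∀ {a b} → ℕ → Labelling a b → ℕ → Set
RunStructured ℓ g x = (∀ z → InSmall g x z → ℓ ∣ z)
                    × ∃[ is ] (∀ z → InLarge g x z ⇔ (∃[ i ] (i ∈ is × InRun ℓ i z)))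

module LargeTop {a b} {g : Labelling a b} {x}
  (α : IsAlphaValuationWith a b g x) (top : InΦLarge g x 1) where
  open IsAlphaValuationWith α

  private
    tiling : IsTiling (InΦLarge g x) (InSmall g x) (a * b)
    tiling = tiling-swap (AlphaValuation.tiling α)

    1<ab : 1 < a * b
    1<ab = m∸n≢0⇒n<m (m<n⇒n≢0 (proj₂ (proj₂ top)))

    0<ab : 0 < a * b
    0<ab = <-trans z<s 1<ab

  open NonEmptyTiling tiling 0<ab

  private
    ΦLarge? : ∀ z → Dec (InΦLarge g x z)
    ΦLarge? z = any-vertex? (λ v → (g v ≟ a * b ∸ z) ×-dec (x <? a * b ∸ z))

    least : ∃[ m ] (¬ InΦLarge g x m × (∀ {k} → k < m → InΦLarge g x k))
    least = least-counterexample ΦLarge? (a * b) (λ A[ab] → <-irrefl refl (A<n A[ab]))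

    m : ℕ
    m = proj₁ least

    1<non-member : ∀ {k} → ¬ InΦLarge g x k → 1 < k
    1<non-member {0} ¬A0 = contradiction 0∈A ¬A0
    1<non-member {1} ¬A1 = contradiction top ¬A1
    1<non-member {suc (suc _)} _ = s≤s (s≤s z≤n)

    1<m : 1 < m
    1<m = 1<non-member (proj₁ (proj₂ least))

    instance
      m-nonZero : NonZero m
      m-nonZero = >-nonZero (<-trans z<s 1<m)

  open BlockStructure tiling 0<ab m (proj₂ (proj₂ least)) (proj₁ (proj₂ least))

  private
    N : ℕ
    N = a * b / m

    ab≡Nm : a * b ≡ N * m
    ab≡Nm = sym (m/n*n≡m m∣n)

  -- Through Φ the run i becomes the block N ∸ i, which Φ(V^large) contains entirely or not at all.
  run-closed : ∀ i {z z'} → InRun m i z → InRun m i z' → InLarge g x z' → InLarge g x z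
  run-closed i {z} {z'} Rz Rz' (w , gw≡z' , x<z') with InRun⇒gap m i Rz | InRun⇒gap m i Rz'
  ... | r , r<m , z+r≡im | r' , r'<m , z'+r'≡im =
    Equivalence.to (ΦΦ-large z≤ab) (subst (InΦLarge g x) (sym (reflect z z+r≡im)) A[r+block])
    where
    z'≤ab : z' ≤ a * b
    z'≤ab = subst (_≤ a * b) gw≡z' (bounded w)
    i≤N : i ≤ N
    i≤N = run-index-bound m N {i} z'+r'≡im (subst (z' ≤_) ab≡Nm z'≤ab) r'<m
    z≤ab : z ≤ a * b
    z≤ab = ≤-trans (m≤m+n z r) (subst₂ _≤_ (sym z+r≡im) (sym ab≡Nm) (*-monoˡ-≤ m i≤N))
    reflect : ∀ y {s} → y + s ≡ i * m → a * b ∸ y ≡ s + (N ∸ i) * m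
    reflect y y+s≡im = trans (cong (_∸ y) ab≡Nm) (reflect-run m N {i} y+s≡im i≤N)
    A[r+block] : InΦLarge g x (r + (N ∸ i) * m)
    A[r+block] = block⊆A (N ∸ i) r<m (A⇒block-start (N ∸ i) r'<m
      (subst (InΦLarge g x) (reflect z' z'+r'≡im) (Equivalence.from (ΦΦ-large z'≤ab) (w , gw≡z' , x<z'))))

  runs : List ℕ
  runs = map (runOf m ∘ g) (filter (λ v → x <? g v) (vertices a b))

  large⇔runs : ∀ z → InLarge g x z ⇔ (∃[ i ] (i ∈ runs × InRun m i z))
  large⇔runs z = mk⇔ to from
    where
    to : InLarge g x z → ∃[ i ] (i ∈ runs × InRun m i z)
    to (v , refl , x<gv) = runOf m (g v)
                         , ∈-map∘filter⁺ (runOf m ∘ g) (λ v → x <? g v) (v , ∈-vertices v , refl , x<gv)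
                         , InRun-runOf m (≤-<-trans z≤n x<gv)
    from : ∃[ i ] (i ∈ runs × InRun m i z) → InLarge g x z
    from (i , i∈runs , Rz)
      with v , _ , refl , x<gv ← ∈-map∘filter⁻ (runOf m ∘ g) (λ v → x <? g v) {xs = vertices a b} i∈runs
      = run-closed i Rz (InRun-runOf m (≤-<-trans z≤n x<gv)) (v , refl , x<gv)

  structure : ∃[ ℓ ] (1 < ℓ × RunStructured ℓ g x)
  structure = m , 1<m , (λ _ → B⇒∣) , runs , large⇔runs

theorem2p9 : (a b : ℕ) (f : Labelling a b) → IsAlphaValuation a b f → 1 < a * b →
    ∃[ ℓ ] (1 < ℓ × ∃[ g ] ∃[ x ] (Equivalent a b f g × IsAlphaValuationWith a b g x
      × (∀ z → InSmall g x z → ℓ ∣ z)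
      × ∃[ is ] (∀ z → InLarge g x z ⇔ (∃[ i ] (i ∈ is × InRun ℓ i z)))))
theorem2p9 a b f (x , α) 1<ab with NonEmptyTiling.1∈A⊎1∈B (AlphaValuation.tiling α) 0<ab 1<ab
  where
  0<ab : 0 < a * b
  0<ab = <-trans z<s 1<ab
... | inj₂ top =
  let ℓ , 1<ℓ , structured = LargeTop.structure α top
  in ℓ , 1<ℓ , f , x , inj₁ (λ _ → refl) , α , structured
... | inj₁ one =
  let ℓ , 1<ℓ , structured = LargeTop.structure Φα (small⇒ΦLarge x<ab one)
  in ℓ , 1<ℓ , _ , _ , inj₂ (λ _ → refl) , Φα , structured
  where
  x<ab : x < a * b
  x<ab = AlphaValuation.threshold<ab α (<-trans z<s 1<ab)
  Φα : IsAlphaValuationWith a b (λ v → Φ a b (f v)) (a * b ∸ suc x)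
  Φα = Φ-valuation α x<ab
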